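{- Let $\mathcal{T}$ be a full binary tree with leaf set $\mathcal{L}$. Suppose $S \subsetneq \mathcal{L}$ is a proper subset and $S = S_1 \cup \dots \cup S_k$ with $S_1,\ldots,S_k \in \operatorname{doad}(\mathcal{T})$, where $k$ is minimal, i.e. $S$ is not the union of fewer than $k$ doad sets of $\mathcal{T}$. Then the sets $S_1,\ldots,S_k$ are pairwise disjoint.
   Context: A full binary tree $\mathcal{T}$ is a finite rooted tree in which every vertex has either exactly two children (a node) or no children (a leaf). For a vertex $v$ of $\mathcal{T}$, let $D_{\mathcal{T}}(v)\subseteq \mathcal{L}$ be the set of leaves that are descendants of $v$ (a leaf is a descendant of itself), and $A_{\mathcal{T}}(v) = \mathcal{L}\setminus D_{\mathcal{T}}(v)$. A subset $S \subseteq \mathcal{L}$ is a doad set of $\mathcal{T}$ if $S = D_{\mathcal{T}}(v)$ or $S = A_{\mathcal{T}}(v)$ for some vertex $v$; $\operatorname{doad}(\mathcal{T})$ denotes the collection of all doad sets. -}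

module Defs where

open import Data.Bool using (Bool; true; false; not)
open import Data.Nat using (ℕ)
open import Data.Fin using (Fin)
open import Data.Product using (Σ; ∃; _×_)
open import Data.Sum using (_⊎_)
open import Relation.Binary.PropositionalEquality using (_≡_)

data Tree : Set where
  leaf : Tree
  node : Tree → Tree → Tree

data Leaf : Tree → Set where
  here  : Leaf leaf
  left  : ∀ {l r} → Leaf l → Leaf (node l r)
  right : ∀ {l r} → Leaf r → Leaf (node l r)

data Vertex : Tree → Set where
  root : ∀ {t} → Vertex t
  inl  : ∀ {l r} → Vertex l → Vertex (node l r)
  inr  : ∀ {l r} → Vertex r → Vertex (node l r)

LeafSet : Tree → Set
LeafSet t = Leaf t → Bool

-- D_T(v): leaves that are descendants of v (a leaf is a descendant of itself).
D : ∀ {t} → Vertex t → LeafSet t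
D root      x         = true
D (inl v)   (left x)  = D v x
D (inl v)   (right x) = false
D (inr v)   (left x)  = false
D (inr v)   (right x) = D v x

A : ∀ {t} → Vertex t → LeafSet t
A v x = not (D v x)

_≐_ : ∀ {t} → LeafSet t → LeafSet t → Set
S ≐ T = ∀ x → S x ≡ T x

IsDoad : (t : Tree) → LeafSet t → Set
IsDoad t S = ∃ λ (v : Vertex t) → (S ≐ D v) ⊎ (S ≐ A v)

⋃ : ∀ {t} {k : ℕ} → (Fin k → LeafSet t) → Leaf t → Set
⋃ {k = k} Ss x = ∃ λ (i : Fin k) → Ss i x ≡ true

IsUnionOf : ∀ {t} {k : ℕ} → LeafSet t → (Fin k → LeafSet t) → Set
IsUnionOf S Ss = ∀ x → (S x ≡ true → ⋃ Ss x) × (⋃ Ss x → S x ≡ true)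

{-# OPTIONS --safe #-}
-- Descendant sets form a hierarchy: any two are nested or disjoint. Hence any two
-- doad sets P, Q are compatible (as splits in phylogenetics): one of P ∩ Q, P ∖ Q,
-- Q ∖ P and 𝓛 ∖ (P ∪ Q) is empty. Two overlapping members of a cover of a proper
-- subset S share a leaf and both miss a leaf outside S, so they are nested and their
-- union is again a doad set; replacing the two by their union gives a shorter cover.
module Submission where

open import Defs
open import Data.Bool using (Bool; true; false; not; _∨_)
open import Data.Bool.Properties using (∨-zeroʳ; ∨-identityʳ; not-involutive)
open import Data.Empty using (⊥-elim)
open import Data.Fin using (Fin; punchIn; punchOut; _≟_)
open import Data.Fin.Properties using (punchIn-punchOut)
open import Data.Nat using (ℕ; _<_; suc)
open import Data.Nat.Properties using (n<1+n)
open import Data.Product using (Σ; ∃; _×_; _,_; proj₁; proj₂)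
open import Data.Sum using (_⊎_; inj₁; inj₂; [_,_]′)
open import Data.Vec.Functional using (updateAt; removeAt)
open import Data.Vec.Functional.Properties using (updateAt-updates; updateAt-minimal)
open import Function using (_∘_; id)
open import Relation.Nullary using (¬_; yes; no)
open import Relation.Binary.PropositionalEquality
  using (_≡_; _≢_; _≗_; refl; sym; trans; subst; cong)

not≡true⇒≢true : ∀ {b} → not b ≡ true → b ≢ true
not≡true⇒≢true {false} _ ()

≢true⇒not≡true : ∀ {b} → b ≢ true → not b ≡ true
≢true⇒not≡true {true}  b≢true = ⊥-elim (b≢true refl)
≢true⇒not≡true {false} _      = refl

∨≡true : ∀ a {b} → a ∨ b ≡ true → a ≡ true ⊎ b ≡ true
∨≡true true  _ = inj₁ refl
∨≡true false h = inj₂ h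

∨-absorbˡ : ∀ a b → (a ≡ true → b ≡ true) → a ∨ b ≡ b
∨-absorbˡ true  b a⇒b = sym (a⇒b refl)
∨-absorbˡ false b _   = refl

∨-absorbʳ : ∀ a b → (b ≡ true → a ≡ true) → a ∨ b ≡ a
∨-absorbʳ a true  b⇒a = trans (∨-zeroʳ a) (sym (b⇒a refl))
∨-absorbʳ a false _   = ∨-identityʳ a

updateAt-elim : ∀ {n} {A : Set} (Q : Fin n → A → Set) (xs : Fin n → A) (i : Fin n) {f : A → A}
  → (∀ a → Q a (xs a)) → Q i (f (xs i)) → ∀ a → Q a (updateAt xs i f a)
updateAt-elim Q xs i Q-xs Q-fxsᵢ a with a ≟ i
... | yes refl = subst (Q a) (sym (updateAt-updates a xs)) Q-fxsᵢ
... | no a≢i   = subst (Q a) (sym (updateAt-minimal a i xs a≢i)) (Q-xs a)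

module _ {X : Set} where

  infix 4 _⊆_
  infixl 6 _∪_

  _⊆_ : (X → Bool) → (X → Bool) → Set
  P ⊆ Q = ∀ x → P x ≡ true → Q x ≡ true

  ∁ : (X → Bool) → X → Bool
  ∁ P = not ∘ P

  _∪_ : (X → Bool) → (X → Bool) → X → Bool
  (P ∪ Q) x = P x ∨ Q x

  private variable P P′ Q Q′ R : X → Bool

  ⊆-refl : P ⊆ P
  ⊆-refl _ = id

  ⊆-trans : P ⊆ Q → Q ⊆ R → P ⊆ R
  ⊆-trans P⊆Q Q⊆R x = Q⊆R x ∘ P⊆Q x

  ⊆-resp-≗ : P ≗ P′ → Q ≗ Q′ → P′ ⊆ Q′ → P ⊆ Q
  ⊆-resp-≗ P≗P′ Q≗Q′ P′⊆Q′ x h = trans (Q≗Q′ x) (P′⊆Q′ x (trans (sym (P≗P′ x)) h))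

  ∁-cong : P ≗ Q → ∁ P ≗ ∁ Q
  ∁-cong P≗Q = cong not ∘ P≗Q

  ∁-antitone : P ⊆ Q → ∁ Q ⊆ ∁ P
  ∁-antitone P⊆Q x x∈∁Q = ≢true⇒not≡true (not≡true⇒≢true x∈∁Q ∘ P⊆Q x)

  ∁-swap : P ⊆ ∁ Q → Q ⊆ ∁ P
  ∁-swap P⊆∁Q x x∈Q = ≢true⇒not≡true (λ x∈P → not≡true⇒≢true (P⊆∁Q x x∈P) x∈Q)

  ∁∁-⊆ : ∁ (∁ P) ⊆ P
  ∁∁-⊆ {P} x h = trans (sym (not-involutive (P x))) h

  ∪-introˡ : P ⊆ P ∪ Q
  ∪-introˡ {Q = Q} x h = cong (_∨ Q x) h

  ∪-introʳ : Q ⊆ P ∪ Q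
  ∪-introʳ {Q} {P} x h = trans (cong (P x ∨_) h) (∨-zeroʳ (P x))

  ∪-elim : ∀ x → (P ∪ Q) x ≡ true → P x ≡ true ⊎ Q x ≡ true
  ∪-elim {P} x = ∨≡true (P x)

  ∪-absorbˡ : P ⊆ Q → P ∪ Q ≗ Q
  ∪-absorbˡ {P} {Q} P⊆Q x = ∨-absorbˡ (P x) (Q x) (P⊆Q x)

  ∪-absorbʳ : Q ⊆ P → P ∪ Q ≗ P
  ∪-absorbʳ {Q} {P} Q⊆P x = ∨-absorbʳ (P x) (Q x) (Q⊆P x)

  data Laminar (P Q : X → Bool) : Set where
    disjoint : P ⊆ ∁ Q → Laminar P Q
    sub      : P ⊆ Q   → Laminar P Q
    super    : Q ⊆ P   → Laminar P Q

  data Compatible (P Q : X → Bool) : Set where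
    disjoint : P ⊆ ∁ Q → Compatible P Q
    sub      : P ⊆ Q   → Compatible P Q
    super    : Q ⊆ P   → Compatible P Q
    covering : ∁ P ⊆ Q → Compatible P Q

  laminar⇒compatible : Laminar P Q → Compatible P Q
  laminar⇒compatible (disjoint P⊆∁Q) = disjoint P⊆∁Q
  laminar⇒compatible (sub P⊆Q)       = sub P⊆Q
  laminar⇒compatible (super Q⊆P)     = super Q⊆P

  compatible-sym : Compatible P Q → Compatible Q P
  compatible-sym (disjoint P⊆∁Q) = disjoint (∁-swap P⊆∁Q)
  compatible-sym (sub P⊆Q)       = super P⊆Q
  compatible-sym (super Q⊆P)     = sub Q⊆P
  compatible-sym (covering ∁P⊆Q) = covering (⊆-trans (∁-antitone ∁P⊆Q) ∁∁-⊆)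

  compatible-∁ˡ : Compatible P Q → Compatible (∁ P) Q
  compatible-∁ˡ (disjoint P⊆∁Q) = super (∁-swap P⊆∁Q)
  compatible-∁ˡ (sub P⊆Q)       = covering (⊆-trans ∁∁-⊆ P⊆Q)
  compatible-∁ˡ (super Q⊆P)     = disjoint (∁-antitone Q⊆P)
  compatible-∁ˡ (covering ∁P⊆Q) = sub ∁P⊆Q

  compatible-∁ʳ : Compatible P Q → Compatible P (∁ Q)
  compatible-∁ʳ = compatible-sym ∘ compatible-∁ˡ ∘ compatible-sym

  compatible-resp-≗ : P ≗ P′ → Q ≗ Q′ → Compatible P′ Q′ → Compatible P Q
  compatible-resp-≗ P≗P′ Q≗Q′ (disjoint P′⊆∁Q′) = disjoint (⊆-resp-≗ P≗P′ (∁-cong Q≗Q′) P′⊆∁Q′)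
  compatible-resp-≗ P≗P′ Q≗Q′ (sub P′⊆Q′)       = sub (⊆-resp-≗ P≗P′ Q≗Q′ P′⊆Q′)
  compatible-resp-≗ P≗P′ Q≗Q′ (super Q′⊆P′)     = super (⊆-resp-≗ Q≗Q′ P≗P′ Q′⊆P′)
  compatible-resp-≗ P≗P′ Q≗Q′ (covering ∁P′⊆Q′) = covering (⊆-resp-≗ (∁-cong P≗P′) Q≗Q′ ∁P′⊆Q′)

  compatible⇒nested : ∀ {x z} → Compatible P Q
    → P x ≡ true → Q x ≡ true → P z ≢ true → Q z ≢ true → P ⊆ Q ⊎ Q ⊆ P
  compatible⇒nested {x = x} (disjoint P⊆∁Q) x∈P x∈Q _ _ =
    ⊥-elim (not≡true⇒≢true (P⊆∁Q x x∈P) x∈Q)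
  compatible⇒nested (sub P⊆Q)   _ _ _ _ = inj₁ P⊆Q
  compatible⇒nested (super Q⊆P) _ _ _ _ = inj₂ Q⊆P
  compatible⇒nested {z = z} (covering ∁P⊆Q) _ _ z∉P z∉Q =
    ⊥-elim (z∉Q (∁P⊆Q z (≢true⇒not≡true z∉P)))

module _ {l r : Tree} where

  -- f is id or not, so that one lemma lifts both inclusions and disjointness.
  inl-⊆ : ∀ (f : Bool → Bool) {u v : Vertex l}
    → D u ⊆ f ∘ D v → D (inl {r = r} u) ⊆ f ∘ D (inl v)
  inl-⊆ f u⊆v (left x) = u⊆v x
  inl-⊆ f u⊆v (right x) ()

  inr-⊆ : ∀ (f : Bool → Bool) {u v : Vertex r}
    → D u ⊆ f ∘ D v → D (inr {l = l} u) ⊆ f ∘ D (inr v)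
  inr-⊆ f u⊆v (left x) ()
  inr-⊆ f u⊆v (right x) = u⊆v x

  laminar-inl : {u v : Vertex l} → Laminar (D u) (D v) → Laminar (D (inl {r = r} u)) (D (inl v))
  laminar-inl (disjoint u⊆∁v) = disjoint (inl-⊆ not u⊆∁v)
  laminar-inl (sub u⊆v)       = sub (inl-⊆ id u⊆v)
  laminar-inl (super v⊆u)     = super (inl-⊆ id v⊆u)

  laminar-inr : {u v : Vertex r} → Laminar (D u) (D v) → Laminar (D (inr {l = l} u)) (D (inr v))
  laminar-inr (disjoint u⊆∁v) = disjoint (inr-⊆ not u⊆∁v)
  laminar-inr (sub u⊆v)       = sub (inr-⊆ id u⊆v)
  laminar-inr (super v⊆u)     = super (inr-⊆ id v⊆u)

D-laminar : ∀ {t} (u v : Vertex t) → Laminar (D u) (D v)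
D-laminar u       root    = sub (λ _ _ → refl)
D-laminar root    (inl v) = super (λ _ _ → refl)
D-laminar root    (inr v) = super (λ _ _ → refl)
D-laminar (inl u) (inl v) = laminar-inl (D-laminar u v)
D-laminar (inl u) (inr v) = disjoint λ { (left x) _ → refl ; (right x) () }
D-laminar (inr u) (inl v) = disjoint λ { (left x) () ; (right x) _ → refl }
D-laminar (inr u) (inr v) = laminar-inr (D-laminar u v)

module _ {t : Tree} where

  private variable P Q : LeafSet t

  doad-resp-≐ : P ≐ Q → IsDoad t Q → IsDoad t P
  doad-resp-≐ P≐Q (v , inj₁ Q≐Dv) = v , inj₁ (λ x → trans (P≐Q x) (Q≐Dv x))
  doad-resp-≐ P≐Q (v , inj₂ Q≐Av) = v , inj₂ (λ x → trans (P≐Q x) (Q≐Av x))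

  doad-compatible : IsDoad t P → IsDoad t Q → Compatible P Q
  doad-compatible (u , inj₁ P≐Du) (v , inj₁ Q≐Dv) =
    compatible-resp-≗ P≐Du Q≐Dv (laminar⇒compatible (D-laminar u v))
  doad-compatible (u , inj₁ P≐Du) (v , inj₂ Q≐Av) =
    compatible-resp-≗ P≐Du Q≐Av (compatible-∁ʳ (laminar⇒compatible (D-laminar u v)))
  doad-compatible (u , inj₂ P≐Au) (v , inj₁ Q≐Dv) =
    compatible-resp-≗ P≐Au Q≐Dv (compatible-∁ˡ (laminar⇒compatible (D-laminar u v)))
  doad-compatible (u , inj₂ P≐Au) (v , inj₂ Q≐Av) =
    compatible-resp-≗ P≐Au Q≐Av (compatible-∁ˡ (compatible-∁ʳ (laminar⇒compatible (D-laminar u v))))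

  doad-∪ : ∀ {x z} → IsDoad t P → IsDoad t Q
    → P x ≡ true → Q x ≡ true → P z ≢ true → Q z ≢ true → IsDoad t (P ∪ Q)
  doad-∪ P-doad Q-doad x∈P x∈Q z∉P z∉Q =
    [ (λ P⊆Q → doad-resp-≐ (∪-absorbˡ P⊆Q) Q-doad)
    , (λ Q⊆P → doad-resp-≐ (∪-absorbʳ Q⊆P) P-doad)
    ]′ (compatible⇒nested (doad-compatible P-doad Q-doad) x∈P x∈Q z∉P z∉Q)

  ⋃-removeAt : ∀ {m x} (Ss : Fin (suc m) → LeafSet t) {j a}
    → j ≢ a → Ss a x ≡ true → ⋃ (removeAt Ss j) x
  ⋃-removeAt {x = x} Ss j≢a x∈Sa =
    punchOut j≢a , subst (λ b → Ss b x ≡ true) (sym (punchIn-punchOut j≢a)) x∈Sa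

module _ {t : Tree} {m : ℕ} (Ss : Fin (suc m) → LeafSet t) (i j : Fin (suc m)) where

  merge : Fin m → LeafSet t
  merge = removeAt (updateAt Ss i (_∪ Ss j)) j

  private
    Ss′ : Fin (suc m) → LeafSet t
    Ss′ = updateAt Ss i (_∪ Ss j)

    ⊆-updated : ∀ a → Ss a ⊆ Ss′ a
    ⊆-updated = updateAt-elim (λ a P → Ss a ⊆ P) Ss i (λ _ → ⊆-refl) ∪-introˡ

    updated-⊆ : ∀ a → Ss′ a ⊆ Ss a ∪ Ss j
    updated-⊆ = updateAt-elim (λ a P → P ⊆ Ss a ∪ Ss j) Ss i (λ _ → ∪-introˡ) ⊆-refl

    ⊆-updatedᵢ : Ss j ⊆ Ss′ i
    ⊆-updatedᵢ = subst (Ss j ⊆_) (sym (updateAt-updates i Ss)) ∪-introʳ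

  ⋃-merge⁺ : i ≢ j → ∀ x → ⋃ Ss x → ⋃ merge x
  ⋃-merge⁺ i≢j x (a , x∈Sa) with a ≟ j
  ... | yes refl = ⋃-removeAt Ss′ (i≢j ∘ sym) (⊆-updatedᵢ x x∈Sa)
  ... | no a≢j   = ⋃-removeAt Ss′ (a≢j ∘ sym) (⊆-updated a x x∈Sa)

  ⋃-merge⁻ : ∀ x → ⋃ merge x → ⋃ Ss x
  ⋃-merge⁻ x (b , x∈merge) =
    [ (λ x∈Sa → punchIn j b , x∈Sa) , (λ x∈Sj → j , x∈Sj) ]′
      (∪-elim {P = Ss (punchIn j b)} {Ss j} x (updated-⊆ (punchIn j b) x x∈merge))

  unionOf-merge : ∀ {S} → i ≢ j → IsUnionOf S Ss → IsUnionOf S merge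
  unionOf-merge i≢j S≡⋃Ss x =
    ⋃-merge⁺ i≢j x ∘ proj₁ (S≡⋃Ss x) , proj₂ (S≡⋃Ss x) ∘ ⋃-merge⁻ x

  merge-all : (Q : LeafSet t → Set) → (∀ a → Q (Ss a)) → Q (Ss i ∪ Ss j) → ∀ b → Q (merge b)
  merge-all Q Q-Ss Q-Sᵢ∪Sⱼ = updateAt-elim (λ _ → Q) Ss i Q-Ss Q-Sᵢ∪Sⱼ ∘ punchIn j

lemma2p10 : (t : Tree) (S : LeafSet t)
    → (∃ λ (x : Leaf t) → S x ≡ false)
    → (k : ℕ) (Ss : Fin k → LeafSet t)
    → (∀ i → IsDoad t (Ss i))
    → IsUnionOf S Ss
    → (∀ (m : ℕ) → m < k → ¬ (Σ (Fin m → LeafSet t) λ Ts → (∀ j → IsDoad t (Ts j)) × IsUnionOf S Ts))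
    → ∀ (i j : Fin k) → i ≢ j → ∀ (x : Leaf t) → ¬ (Ss i x ≡ true × Ss j x ≡ true)
lemma2p10 t S (z , z∉S) (suc m) Ss Ss-doad S≡⋃Ss minimal i j i≢j x (x∈Sᵢ , x∈Sⱼ) =
  minimal m (n<1+n m)
    ( merge Ss i j
    , merge-all Ss i j (IsDoad t) Ss-doad
        (doad-∪ (Ss-doad i) (Ss-doad j) x∈Sᵢ x∈Sⱼ (z∉Ss i) (z∉Ss j))
    , unionOf-merge Ss i j i≢j S≡⋃Ss )
  where
  z∉Ss : ∀ a → Ss a z ≢ true
  z∉Ss a z∈Sa with trans (sym z∉S) (proj₂ (S≡⋃Ss z) (a , z∈Sa))
  ... | ()
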